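{- Let $S$ be a finite transformation semigroup on a finite set and let $f_1,\dots,f_k$ be representatives of the $\mathcal{R}$-classes of $S$ (one from each class). Then $\mathrm{Gr}(S)=\mathrm{Gr}(\{f_1,\dots,f_k\})$.
   Context: Transformations act on the right. For a set $M$ of transformations of a finite set $V$, $\mathrm{Gr}(M)$ is the graph on $V$ in which distinct $v,w$ are adjacent iff there is no $f\in M$ with $vf=wf$. Green's relation $\mathcal{R}$ on $S$: $f\,\mathcal{R}\,g$ iff $fS^1=gS^1$, where $S^1$ is $S$ with an identity adjoined. -}

module Defs where

open import Data.Nat using (ℕ)
open import Data.Fin using (Fin)
open import Data.List using (List)
open import Data.List.Relation.Unary.Any using (Any)
open import Data.List.Relation.Unary.All using (All)
open import Data.List.Relation.Unary.AllPairs using (AllPairs)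
open import Data.Product using (Σ; _×_; ∃)
open import Data.Sum using (_⊎_)
open import Relation.Binary.PropositionalEquality using (_≡_; _≢_; _≗_)
open import Relation.Nullary using (¬_)

Trans : ℕ → Set
Trans n = Fin n → Fin n

-- Transformations act on the right: v (f ⨾ g) = (v f) g.
_⨾_ : ∀ {n} → Trans n → Trans n → Trans n
(f ⨾ g) v = g (f v)

-- A finite set of transformations, given as a list; membership is up to
-- (pointwise) equality of transformations.
TSet : ℕ → Set
TSet n = List (Trans n)

_∈ₜ_ : ∀ {n} → Trans n → TSet n → Set
h ∈ₜ M = Any (λ g → g ≗ h) M

IsTransSemigroup : ∀ {n} → TSet n → Set
IsTransSemigroup {n} S = ∀ (f g : Trans n) → f ∈ₜ S → g ∈ₜ S → (f ⨾ g) ∈ₜ S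

_∈¹_ : ∀ {n} → Trans n → TSet n → Set
a ∈¹ S = (∀ v → a v ≡ v) ⊎ (a ∈ₜ S)

InRightIdeal : ∀ {n} → TSet n → Trans n → Trans n → Set
InRightIdeal {n} S f h = Σ (Trans n) λ a → a ∈¹ S × (h ≗ (f ⨾ a))

GreenR : ∀ {n} → TSet n → Trans n → Trans n → Set
GreenR {n} S f g =
  (∀ (h : Trans n) → InRightIdeal S f h → InRightIdeal S g h) ×
  (∀ (h : Trans n) → InRightIdeal S g h → InRightIdeal S f h)

IsRReps : ∀ {n} → TSet n → List (Trans n) → Set
IsRReps {n} S fs =
  All (λ f → f ∈ₜ S) fs ×
  (∀ (f : Trans n) → f ∈ₜ S → Any (λ g → GreenR S f g) fs) ×
  AllPairs (λ f g → ¬ GreenR S f g) fs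

GrAdj : ∀ {n} → TSet n → Fin n → Fin n → Set
GrAdj {n} M v w = v ≢ w × ¬ (Σ (Trans n) λ f → f ∈ₜ M × f v ≡ f w)

module Submission where

-- Two distinct points v, w are adjacent in Gr(M) exactly when no
-- member of M collapses them (maps v and w to the same point).  Hence if every
-- collapsing member of M yields a collapsing member of N, adjacency in Gr(N)
-- implies adjacency in Gr(M) (lemma adjacency-transfer).  It thus suffices to
-- move collapsing transformations between S and the representatives fs:
--   * fs → S: every representative lies in S (collapse-from-members);
--   * S → fs: if f ∈ S collapses v, w and f R g, then g ∈ g S¹ ⊆ f S¹, so
--     g = f a for some a ∈ S¹; the kernel of f is contained in the kernel of
--     f a, so g collapses v, w as well (collapse-along-R).  Since every element
--     of S is R-related to some representative, fs contains a collapsing map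
--     (collapse-to-representatives).

open import Defs
open import Data.Nat using (ℕ)
open import Data.Fin using (Fin)
open import Data.List using (List)
open import Data.Product using (Σ; _×_; _,_)
open import Data.Sum using (inj₁)
open import Data.List.Relation.Unary.Any using (Any; here; there)
open import Data.List.Relation.Unary.All using (All; _∷_)
open import Relation.Binary.PropositionalEquality
  using (_≡_; refl; sym; trans; cong; module ≡-Reasoning)

Collapses : ∀ {n} → TSet n → Fin n → Fin n → Set
Collapses {n} M v w = Σ (Trans n) λ f → f ∈ₜ M × f v ≡ f w

adjacency-transfer : ∀ {n} {M N : TSet n} {v w : Fin n} →
  (Collapses M v w → Collapses N v w) → GrAdj N v w → GrAdj M v w
adjacency-transfer M⇒N (v≢w , ¬collapseN) = v≢w , λ c → ¬collapseN (M⇒N c)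

collapse-≗ : ∀ {n} {f g : Trans n} {v w : Fin n} →
  (∀ x → f x ≡ g x) → g v ≡ g w → f v ≡ f w
collapse-≗ {f = f} {g} {v} {w} f≗g gv≡gw = begin
  f v ≡⟨ f≗g v ⟩
  g v ≡⟨ gv≡gw ⟩
  g w ≡⟨ sym (f≗g w) ⟩
  f w ∎
  where open ≡-Reasoning

collapse-from-members : ∀ {n} {S fs : TSet n} {v w : Fin n} →
  All (λ f → f ∈ₜ S) fs → Collapses fs v w → Collapses S v w
collapse-from-members (x∈S ∷ _) (h , here x≗h , hv≡hw) =
  _ , x∈S , collapse-≗ x≗h hv≡hw
collapse-from-members (_ ∷ rest) (h , there h∈fs , hv≡hw) =
  collapse-from-members rest (h , h∈fs , hv≡hw)

right-ideal-kernel : ∀ {n} {S : TSet n} {f h : Trans n} {v w : Fin n} →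
  InRightIdeal S f h → f v ≡ f w → h v ≡ h w
right-ideal-kernel (a , _ , h≗fa) fv≡fw =
  collapse-≗ h≗fa (cong a fv≡fw)

in-own-right-ideal : ∀ {n} (S : TSet n) (g : Trans n) → InRightIdeal S g g
in-own-right-ideal S g = (λ x → x) , inj₁ (λ _ → refl) , λ _ → refl

-- If f R g, every pair collapsed by f is collapsed by g, since g ∈ g S¹ ⊆ f S¹
-- (by symmetry R-related maps have equal kernels).
collapse-along-R : ∀ {n} {S : TSet n} {f g : Trans n} {v w : Fin n} →
  GreenR S f g → f v ≡ f w → g v ≡ g w
collapse-along-R {S = S} {g = g} (_ , gS¹⊆fS¹) =
  right-ideal-kernel (gS¹⊆fS¹ g (in-own-right-ideal S g))

collapse-to-representatives : ∀ {n} {S fs : TSet n} {f : Trans n} {v w : Fin n} →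
  Any (GreenR S f) fs → f v ≡ f w → Collapses fs v w
collapse-to-representatives (here {x = g} fRg) fv≡fw =
  g , here (λ _ → refl) , collapse-along-R fRg fv≡fw
collapse-to-representatives (there g∈fs) fv≡fw
  with collapse-to-representatives g∈fs fv≡fw
... | g , g∈rest , gv≡gw = g , there g∈rest , gv≡gw

mainTheorem11 : (n : ℕ) (S : TSet n) → IsTransSemigroup S →
    (fs : List (Trans n)) → IsRReps S fs →
    (v w : Fin n) →
    (GrAdj S v w → GrAdj fs v w) × (GrAdj fs v w → GrAdj S v w)
mainTheorem11 n S _ fs (reps⊆S , covered , _) v w =
  adjacency-transfer (collapse-from-members reps⊆S) ,
  adjacency-transfer S⇒fs
  where
  S⇒fs : Collapses S v w → Collapses fs v w
  S⇒fs (f , f∈S , fv≡fw) = collapse-to-representatives (covered f f∈S) fv≡fw
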